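{- Let $m\ge 3$ be odd, let $i$ be a positive integer with $\gcd(i,m)=1$, let $q=2^i$, and let $a\in\mathbb{F}_{2^m}^*$. Consider the following polynomials in $\mathbb{F}_{2^m}[T]$: \begin{align*} P_a(T)&=T^{q^2+q+1}+(aT^q+1)^{q+1},\\ P_a'(T)&=T^{q^2+q+1}+aT^{q^2+q}+1,\\ Q_a(T)&=T^{q^2+q+1}+aT+1,\\ Q_{a^q}(T)&=T^{q^2+q+1}+a^qT+1,\\ R_a(T)&=T^{q^2+q+1}+(aT+1)^{q+1},\\ S_a(T)&=T^{q^2+q+1}+a^qT^{q+1}+1. \end{align*} Then each of these polynomials takes the value $1$ at $T=0$ (so none has $0$ as a root), and any one of them has a root in $\mathbb{F}_{2^m}^*$ if and only if all of them have a root in $\mathbb{F}_{2^m}^*$.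
   Context: $\mathbb{F}_{2^m}$ denotes the finite field with $2^m$ elements and $\mathbb{F}_{2^m}^*$ its multiplicative group. -}

module Defs where

open import Level using (Level; _⊔_) renaming (suc to lsuc)
open import Data.Nat using (ℕ) renaming (_+_ to _+ℕ_; _*_ to _*ℕ_; _^_ to _^ℕ_)
open import Data.Fin using (Fin; zero; suc)
open import Data.Product using (Σ; ∃; _×_)
open import Relation.Nullary using (¬_)
open import Relation.Binary.PropositionalEquality as ≡ using (_≡_)
open import Algebra.Bundles using (CommutativeRing)
import Algebra.Bundles
open import Function.Bundles using (Bijection)
import Algebra.Definitions.RawSemiring as RS

-- A finite field with exactly 2^m elements: a commutative ring in which
-- 1 ≠ 0, every nonzero element is invertible, and whose carrier (as a setoid)
-- is in bijection with Fin (2^m).  (Any such field is F_{2^m}, unique up to iso.)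
record FiniteField2^ (m : ℕ) (c ℓ : Level) : Set (lsuc (c ⊔ ℓ)) where
  field
    commRing : CommutativeRing c ℓ
  open CommutativeRing commRing public
  field
    1≉0     : ¬ (1# ≈ 0#)
    inverse : ∀ x → ¬ (x ≈ 0#) → ∃ λ y → x * y ≈ 1#
    card    : Bijection (≡.setoid (Fin (2 ^ℕ m))) setoid

  open RS (Algebra.Bundles.Semiring.rawSemiring semiring) public using (_^_)

  HasRootInF* : (Carrier → Carrier) → Set (c ⊔ ℓ)
  HasRootInF* f = ∃ λ x → ¬ (x ≈ 0#) × (f x ≈ 0#)

-- The six polynomials of the statement (as polynomial functions on F),
-- with q = 2^i.  Index: 0 = P_a, 1 = P'_a, 2 = Q_a, 3 = Q_{a^q}, 4 = R_a, 5 = S_a.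
module Polys {m : ℕ} {c ℓ : Level} (F : FiniteField2^ m c ℓ) (i : ℕ) where
  open FiniteField2^ F

  q : ℕ
  q = 2 ^ℕ i

  N : ℕ
  N = q *ℕ q +ℕ q +ℕ 1

  poly : Fin 6 → Carrier → Carrier → Carrier
  poly zero                            a T = T ^ N + (a * T ^ q + 1#) ^ (q +ℕ 1)
  poly (suc zero)                      a T = T ^ N + a * T ^ (q *ℕ q +ℕ q) + 1#
  poly (suc (suc zero))                a T = T ^ N + a * T + 1#
  poly (suc (suc (suc zero)))          a T = T ^ N + (a ^ q) * T + 1#
  poly (suc (suc (suc (suc zero))))    a T = T ^ N + (a * T + 1#) ^ (q +ℕ 1)
  poly (suc (suc (suc (suc (suc zero))))) a T = T ^ N + (a ^ q) * T ^ (q +ℕ 1) + 1#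

-- Let N = q² + q + 1, Q_d T = T ^ N + d T + 1 and S_d T = T ^ N + d T ^ (q + 1) + 1 (the
-- statement's S_a is S_{a^q}), σ u = u ^ q and ρ u = u ^ (q - 1). Multiplying by u turns
-- Q_d (ρ u) into the q-linearised polynomial L_d u = u ^ q³ + d u ^ q + u, and S_d (ρ v) into
-- M_d v = v ^ q³ + d v ^ q² + v. As gcd (i , m) = 1, the only nonzero fixed point of σ is 1,
-- so ρ is a bijection of F and roots of Q_d, S_d in F* correspond to nonzero zeros of L_d, M_d.
-- For odd m, Tr 1 = 1 makes the trace form (x , y) ↦ Tr (x y) nondegenerate, and
-- Tr (σ³ x · M_{d^q²} y) = Tr (L_d x · y) shows that L_d and M_{d^q²} have nonzero zeros
-- together. The rest is substitution: σ replaces d by d ^ q in Q_d and S_d, T ↦ 1/T exchanges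
-- Q_a with P'_a, and T = z ^ (q + 1) exchanges P_a with P'_a and R_a with S_a.

module Submission where

open import Defs
open import Level using (Level)
open import Data.Nat using (ℕ; zero; suc; NonZero; _≤_; _%_)
import Data.Nat as ℕ
import Data.Nat.Properties as ℕ
import Data.Nat.DivMod as DivMod
open import Data.Nat.GCD using (gcd; GCD; gcd-GCD; module Bézout)
open import Data.Nat.Tactic.RingSolver using (solve-∀)
open import Data.Fin using (Fin; zero; suc; punchOut; punchIn)
open import Data.Fin.Patterns using (0F; 1F; 2F; 3F; 4F; 5F)
open import Data.Fin.Permutation using (Permutation)
import Data.Fin.Properties as Fin
open import Data.Vec.Functional using (removeAt)
open import Data.Product using (_×_; _,_; proj₁; proj₂; ∃)
open import Relation.Nullary using (¬_; Dec; yes; no)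
open import Relation.Nullary.Negation using (contradiction)
open import Relation.Binary.PropositionalEquality as ≡ using (_≡_; _≢_)
import Relation.Binary.Reasoning.Setoid as SetoidReasoning
open import Function.Bundles using (Bijection; Equivalence; mk↔ₛ′; _⇔_; mk⇔)
open import Function.Properties.Equivalence using () renaming (refl to ⇔-refl; trans to ⇔-trans; sym to ⇔-sym)
open import Algebra.Bundles using (CommutativeRing; CommutativeMonoid; Semiring)
import Algebra.Properties.CommutativeMonoid.Sum as CommutativeMonoidSum
import Algebra.Properties.CommutativeSemigroup as CommutativeSemigroupProperties
import Algebra.Properties.CommutativeSemiring.Exp as CommutativeSemiringExp
import Algebra.Properties.Group as GroupProperties
import Algebra.Properties.Ring as RingProperties
import Algebra.Properties.Semiring.Exp as SemiringExp

fin-injective⇒surjective : ∀ {n} (f : Fin n → Fin n) → (∀ {k l} → f k ≡ f l → k ≡ l) →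
                           ∀ j → ∃ λ k → f k ≡ j
fin-injective⇒surjective {suc n} f f-inj j with Fin.any? (λ k → f k Fin.≟ j)
... | yes hit = hit
... | no miss = contradiction (Fin.injective⇒≤ punchOut∘f-inj) ℕ.1+n≰n
  where
  f≢j : ∀ k → j ≢ f k
  f≢j k j≡fk = miss (k , ≡.sym j≡fk)
  punchOut∘f-inj : ∀ {k l} → punchOut (f≢j k) ≡ punchOut (f≢j l) → k ≡ l
  punchOut∘f-inj e = f-inj (Fin.punchOut-injective (f≢j _) (f≢j _) e)

module SemiringPowers {c ℓ} (S : Semiring c ℓ) where
  open Semiring S
  open SemiringExp S
  open SetoidReasoning setoid

  1^n≈1 : ∀ n → 1# ^ n ≈ 1#
  1^n≈1 zero    = refl
  1^n≈1 (suc n) = trans (*-identityˡ (1# ^ n)) (1^n≈1 n)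

  0^n≈0 : ∀ n .{{_ : NonZero n}} → 0# ^ n ≈ 0#
  0^n≈0 (suc n) = zeroˡ (0# ^ n)

  0^[n+1]≈0 : ∀ n → 0# ^ (n ℕ.+ 1) ≈ 0#
  0^[n+1]≈0 n = 0^n≈0 (n ℕ.+ 1) {{ℕ.≢-nonZero (ℕ.m+1+n≢0 n)}}

  ^[n^ke]-fixed : ∀ {w} n e → w ^ (n ℕ.^ e) ≈ w → ∀ k → w ^ (n ℕ.^ (k ℕ.* e)) ≈ w
  ^[n^ke]-fixed {w} n e fixed zero    = *-identityʳ w
  ^[n^ke]-fixed {w} n e fixed (suc k) = begin
    w ^ (n ℕ.^ (e ℕ.+ k ℕ.* e))             ≈⟨ ^-congʳ w (ℕ.^-distribˡ-+-* n e (k ℕ.* e)) ⟩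
    w ^ (n ℕ.^ e ℕ.* n ℕ.^ (k ℕ.* e))       ≈⟨ ^-assocʳ w (n ℕ.^ e) (n ℕ.^ (k ℕ.* e)) ⟨
    (w ^ (n ℕ.^ e)) ^ (n ℕ.^ (k ℕ.* e))     ≈⟨ ^-congˡ (n ℕ.^ (k ℕ.* e)) fixed ⟩
    w ^ (n ℕ.^ (k ℕ.* e))                   ≈⟨ ^[n^ke]-fixed n e fixed k ⟩
    w                                       ∎

  ^n-fixed-of-successor : ∀ {w s t} n → w ^ (n ℕ.^ s) ≈ w → w ^ (n ℕ.^ t) ≈ w → suc t ≡ s → w ^ n ≈ w
  ^n-fixed-of-successor {w} {t = t} n fixedˢ fixedᵗ ≡.refl = begin
    w ^ n                      ≈⟨ ^-congˡ n fixedᵗ ⟨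
    (w ^ (n ℕ.^ t)) ^ n        ≈⟨ ^-assocʳ w (n ℕ.^ t) n ⟩
    w ^ (n ℕ.^ t ℕ.* n)        ≈⟨ ^-congʳ w (ℕ.*-comm (n ℕ.^ t) n) ⟩
    w ^ (n ℕ.^ suc t)          ≈⟨ fixedˢ ⟩
    w                          ∎

  ^n-fixed-of-coprime : ∀ {w} n a b → gcd a b ≡ 1 →
                        w ^ (n ℕ.^ a) ≈ w → w ^ (n ℕ.^ b) ≈ w → w ^ n ≈ w
  ^n-fixed-of-coprime {w} n a b gcd≡1 fixedᵃ fixedᵇ
    with Bézout.identity (≡.subst (GCD a b) gcd≡1 (gcd-GCD a b))
  ... | Bézout.+- x y 1+yb≡xa = ^n-fixed-of-successor n (^[n^ke]-fixed n a fixedᵃ x) (^[n^ke]-fixed n b fixedᵇ y) 1+yb≡xa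
  ... | Bézout.-+ x y 1+xa≡yb = ^n-fixed-of-successor n (^[n^ke]-fixed n b fixedᵇ y) (^[n^ke]-fixed n a fixedᵃ x) 1+xa≡yb

module ThreeTermSums {c ℓ} (S : Semiring c ℓ) where
  open Semiring S
  open CommutativeSemigroupProperties +-commutativeSemigroup using (interchange)

  *-distribˡ-+³ : ∀ u x y z → u * (x + y + z) ≈ u * x + u * y + u * z
  *-distribˡ-+³ u x y z = trans (distribˡ u (x + y) z) (+-congʳ (distribˡ u x y))

  *-distribʳ-+³ : ∀ u x y z → (x + y + z) * u ≈ x * u + y * u + z * u
  *-distribʳ-+³ u x y z = trans (distribʳ u (x + y) z) (+-congʳ (distribʳ u x y))

  +-interchange³ : ∀ x y z x′ y′ z′ → (x + x′) + (y + y′) + (z + z′) ≈ (x + y + z) + (x′ + y′ + z′)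
  +-interchange³ x y z x′ y′ z′ =
    trans (+-congʳ (interchange x x′ y y′)) (interchange (x + y) (x′ + y′) z z′)

module CommutativeMonoidSums {a ℓ} (M : CommutativeMonoid a ℓ) where
  open CommutativeMonoid M renaming (_∙_ to _+_)
  open CommutativeMonoidSum M using (sum; sum-remove; sum-cong-≋)
  open CommutativeSemigroupProperties commutativeSemigroup using (x∙yz≈y∙xz)
  open SetoidReasoning setoid

  sum-cross-at : ∀ {n} (s t : Fin n → Carrier) k → (∀ j → j ≢ k → s j ≈ t j) →
                 t k + sum s ≈ s k + sum t
  sum-cross-at {suc n} s t k agree = begin
    t k + sum s                          ≈⟨ ∙-congˡ (sum-remove {i = k} s) ⟩
    t k + (s k + sum (removeAt s k))     ≈⟨ x∙yz≈y∙xz (t k) (s k) _ ⟩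
    s k + (t k + sum (removeAt s k))
      ≈⟨ ∙-congˡ (∙-congˡ (sum-cong-≋ λ j → agree (punchIn k j) (Fin.punchInᵢ≢i k j))) ⟩
    s k + (t k + sum (removeAt t k))     ≈⟨ ∙-congˡ (sum-remove {i = k} t) ⟨
    s k + sum t                          ∎

HasCharacteristic2 : ∀ {c ℓ} → CommutativeRing c ℓ → Set ℓ
HasCharacteristic2 R = 1# + 1# ≈ 0#
  where open CommutativeRing R

module Characteristic2 {c ℓ} (R : CommutativeRing c ℓ) (1+1≈0 : HasCharacteristic2 R) where
  open CommutativeRing R
  open SemiringExp semiring
  open SemiringPowers semiring using (1^n≈1)
  open CommutativeSemigroupProperties +-commutativeSemigroup using (interchange; xy∙z≈xz∙y)
  open SetoidReasoning setoid

  x+x≈0 : ∀ x → x + x ≈ 0#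
  x+x≈0 x = begin
    x + x                ≈⟨ +-cong (*-identityˡ x) (*-identityˡ x) ⟨
    1# * x + 1# * x      ≈⟨ distribʳ x 1# 1# ⟨
    (1# + 1#) * x        ≈⟨ *-congʳ 1+1≈0 ⟩
    0# * x               ≈⟨ zeroˡ x ⟩
    0#                   ∎

  x+y≈0⇒x≈y : ∀ {x y} → x + y ≈ 0# → x ≈ y
  x+y≈0⇒x≈y {x} {y} x+y≈0 = begin
    x                ≈⟨ +-identityʳ x ⟨
    x + 0#           ≈⟨ +-congˡ (x+x≈0 y) ⟨
    x + (y + y)      ≈⟨ +-assoc x y y ⟨
    (x + y) + y      ≈⟨ +-congʳ x+y≈0 ⟩
    0# + y           ≈⟨ +-identityˡ y ⟩
    y                ∎

  x≈y⇒x+y≈0 : ∀ {x y} → x ≈ y → x + y ≈ 0#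
  x≈y⇒x+y≈0 {y = y} x≈y = trans (+-congʳ x≈y) (x+x≈0 y)

  x+y+z≈0⇒x≈y+z : ∀ {x y z} → x + y + z ≈ 0# → x ≈ y + z
  x+y+z≈0⇒x≈y+z {x} {y} {z} e = x+y≈0⇒x≈y (trans (sym (+-assoc x y z)) e)

  x^2≈x*x : ∀ x → x ^ 2 ≈ x * x
  x^2≈x*x x = *-congˡ (*-identityʳ x)

  ^2-homo-+ : ∀ x y → (x + y) ^ 2 ≈ x ^ 2 + y ^ 2
  ^2-homo-+ x y = begin
    (x + y) ^ 2                             ≈⟨ x^2≈x*x (x + y) ⟩
    (x + y) * (x + y)                       ≈⟨ distribʳ (x + y) x y ⟩
    x * (x + y) + y * (x + y)               ≈⟨ +-cong (distribˡ x x y) (distribˡ y x y) ⟩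
    (x * x + x * y) + (y * x + y * y)       ≈⟨ +-congˡ (+-congʳ (*-comm y x)) ⟩
    (x * x + x * y) + (x * y + y * y)       ≈⟨ +-assoc (x * x) (x * y) (x * y + y * y) ⟩
    x * x + (x * y + (x * y + y * y))       ≈⟨ +-congˡ (+-assoc (x * y) (x * y) (y * y)) ⟨
    x * x + ((x * y + x * y) + y * y)       ≈⟨ +-congˡ (+-congʳ (x+x≈0 (x * y))) ⟩
    x * x + (0# + y * y)                    ≈⟨ +-congˡ (+-identityˡ (y * y)) ⟩
    x * x + y * y                           ≈⟨ +-cong (x^2≈x*x x) (x^2≈x*x y) ⟨
    x ^ 2 + y ^ 2                           ∎

  ^2^k-homo-+ : ∀ k x y → (x + y) ^ (2 ℕ.^ k) ≈ x ^ (2 ℕ.^ k) + y ^ (2 ℕ.^ k)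
  ^2^k-homo-+ zero    x y = trans (*-identityʳ (x + y)) (sym (+-cong (*-identityʳ x) (*-identityʳ y)))
  ^2^k-homo-+ (suc k) x y = begin
    (x + y) ^ (2 ℕ.* 2 ℕ.^ k)                    ≈⟨ ^-assocʳ (x + y) 2 (2 ℕ.^ k) ⟨
    ((x + y) ^ 2) ^ (2 ℕ.^ k)                    ≈⟨ ^-congˡ (2 ℕ.^ k) (^2-homo-+ x y) ⟩
    (x ^ 2 + y ^ 2) ^ (2 ℕ.^ k)                  ≈⟨ ^2^k-homo-+ k (x ^ 2) (y ^ 2) ⟩
    (x ^ 2) ^ (2 ℕ.^ k) + (y ^ 2) ^ (2 ℕ.^ k)    ≈⟨ +-cong (^-assocʳ x 2 (2 ℕ.^ k)) (^-assocʳ y 2 (2 ℕ.^ k)) ⟩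
    x ^ (2 ℕ.* 2 ℕ.^ k) + y ^ (2 ℕ.* 2 ℕ.^ k)    ∎

  tr : ℕ → Carrier → Carrier
  tr zero    x = 0#
  tr (suc k) x = tr k x + x ^ (2 ℕ.^ k)

  tr-cong : ∀ k {x y} → x ≈ y → tr k x ≈ tr k y
  tr-cong zero    x≈y = refl
  tr-cong (suc k) x≈y = +-cong (tr-cong k x≈y) (^-congˡ (2 ℕ.^ k) x≈y)

  tr-homo-+ : ∀ k x y → tr k (x + y) ≈ tr k x + tr k y
  tr-homo-+ zero    x y = sym (+-identityʳ 0#)
  tr-homo-+ (suc k) x y = trans (+-cong (tr-homo-+ k x y) (^2^k-homo-+ k x y))
                                (interchange (tr k x) (tr k y) (x ^ (2 ℕ.^ k)) (y ^ (2 ℕ.^ k)))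

  tr-^2 : ∀ k x → tr k (x ^ 2) + x ≈ tr k x + x ^ (2 ℕ.^ k)
  tr-^2 zero    x = +-congˡ (sym (*-identityʳ x))
  tr-^2 (suc k) x = begin
    (tr k (x ^ 2) + (x ^ 2) ^ (2 ℕ.^ k)) + x    ≈⟨ xy∙z≈xz∙y (tr k (x ^ 2)) ((x ^ 2) ^ (2 ℕ.^ k)) x ⟩
    (tr k (x ^ 2) + x) + (x ^ 2) ^ (2 ℕ.^ k)    ≈⟨ +-cong (tr-^2 k x) (^-assocʳ x 2 (2 ℕ.^ k)) ⟩
    (tr k x + x ^ (2 ℕ.^ k)) + x ^ (2 ℕ.* 2 ℕ.^ k) ∎

  tr-1-odd : ∀ k → tr (suc (k ℕ.* 2)) 1# ≈ 1#
  tr-1-odd zero    = trans (+-identityˡ (1# ^ 1)) (*-identityʳ 1#)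
  tr-1-odd (suc k) = begin
    (tr (suc (k ℕ.* 2)) 1# + 1# ^ (2 ℕ.^ suc (k ℕ.* 2))) + 1# ^ (2 ℕ.^ suc (suc (k ℕ.* 2)))
      ≈⟨ +-cong (+-congˡ (1^n≈1 (2 ℕ.^ suc (k ℕ.* 2)))) (1^n≈1 (2 ℕ.^ suc (suc (k ℕ.* 2)))) ⟩
    (tr (suc (k ℕ.* 2)) 1# + 1#) + 1#  ≈⟨ +-assoc _ 1# 1# ⟩
    tr (suc (k ℕ.* 2)) 1# + (1# + 1#)  ≈⟨ +-cong (tr-1-odd k) 1+1≈0 ⟩
    1# + 0#                            ≈⟨ +-identityʳ 1# ⟩
    1#                                 ∎

module FiniteFieldProperties {m c ℓ} (F : FiniteField2^ m c ℓ) where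
  open FiniteField2^ F hiding (zero)
  open SemiringExp semiring hiding (_^_)
  open SemiringPowers semiring using (1^n≈1; 0^n≈0)
  open RingProperties ring using (-1*x≈-x; -‿involutive)
  open SetoidReasoning setoid
  open Bijection card using ()
    renaming (to to element; injective to element-injective; strictlySurjective to element-surjective)

  index : Carrier → Fin (2 ℕ.^ m)
  index x = proj₁ (element-surjective x)

  element-index : ∀ x → element (index x) ≈ x
  element-index x = proj₂ (element-surjective x)

  index-cong : ∀ {x y} → x ≈ y → index x ≡ index y
  index-cong {x} {y} x≈y = element-injective (trans (element-index x) (trans x≈y (sym (element-index y))))

  index-element : ∀ k → index (element k) ≡ k
  index-element k = element-injective (element-index (element k))

  _≟_ : ∀ x y → Dec (x ≈ y)
  x ≟ y with index x Fin.≟ index y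
  ... | yes ix≡iy = yes (trans (sym (element-index x)) (trans (reflexive (≡.cong element ix≡iy)) (element-index y)))
  ... | no ix≢iy  = no (λ x≈y → ix≢iy (index-cong x≈y))

  injective⇒surjective : (f : Carrier → Carrier) → (∀ {x y} → x ≈ y → f x ≈ f y) →
                          (∀ {x y} → f x ≈ f y → x ≈ y) → ∀ y → ∃ λ x → f x ≈ y
  injective⇒surjective f f-cong f-inj y
    with fin-injective⇒surjective (λ k → index (f (element k))) index∘f-inj (index y)
    where
    index∘f-inj : ∀ {k l} → index (f (element k)) ≡ index (f (element l)) → k ≡ l
    index∘f-inj e = element-injective (f-inj
      (trans (sym (element-index _)) (trans (reflexive (≡.cong element e)) (element-index _))))
  ... | k , e = element k , trans (sym (element-index _)) (trans (reflexive (≡.cong element e)) (element-index y))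

  HasRootInF*? : (f : Carrier → Carrier) → (∀ {x y} → x ≈ y → f x ≈ f y) → Dec (HasRootInF* f)
  HasRootInF*? f f-cong with Fin.any? (λ k → root? (element k))
    where
    root? : ∀ x → Dec (¬ x ≈ 0# × f x ≈ 0#)
    root? x with x ≟ 0# | f x ≟ 0#
    ... | yes x≈0 | _        = no (λ (x≉0 , _) → x≉0 x≈0)
    ... | no x≉0  | yes fx≈0 = yes (x≉0 , fx≈0)
    ... | no _    | no fx≉0  = no (λ (_ , fx≈0) → fx≉0 fx≈0)
  ... | yes (k , root) = yes (element k , root)
  ... | no noRoot      = no λ (x , x≉0 , fx≈0) → noRoot (index x ,
          (λ e → x≉0 (trans (sym (element-index x)) e)) , trans (f-cong (element-index x)) fx≈0)

  *-cancelʳ : ∀ {x y z} → ¬ z ≈ 0# → x * z ≈ y * z → x ≈ y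
  *-cancelʳ {x} {y} {z} z≉0 e with inverse z z≉0
  ... | z⁻¹ , zz⁻¹≈1 = begin
    x               ≈⟨ *-identityʳ x ⟨
    x * 1#          ≈⟨ *-congˡ zz⁻¹≈1 ⟨
    x * (z * z⁻¹)   ≈⟨ *-assoc x z z⁻¹ ⟨
    (x * z) * z⁻¹   ≈⟨ *-congʳ e ⟩
    (y * z) * z⁻¹   ≈⟨ *-assoc y z z⁻¹ ⟩
    y * (z * z⁻¹)   ≈⟨ *-congˡ zz⁻¹≈1 ⟩
    y * 1#          ≈⟨ *-identityʳ y ⟩
    y               ∎

  x*y≈0⇒y≈0 : ∀ {x y} → ¬ x ≈ 0# → x * y ≈ 0# → y ≈ 0#
  x*y≈0⇒y≈0 {x} {y} x≉0 xy≈0 = *-cancelʳ x≉0 (trans (*-comm y x) (trans xy≈0 (sym (zeroˡ x))))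

  x*y≉0 : ∀ {x y} → ¬ x ≈ 0# → ¬ y ≈ 0# → ¬ x * y ≈ 0#
  x*y≉0 x≉0 y≉0 xy≈0 = y≉0 (x*y≈0⇒y≈0 x≉0 xy≈0)

  x*y≈1⇒y≉0 : ∀ {x y} → x * y ≈ 1# → ¬ y ≈ 0#
  x*y≈1⇒y≉0 {x} xy≈1 y≈0 = 1≉0 (trans (sym xy≈1) (trans (*-congˡ y≈0) (zeroʳ x)))

  x^n≉0 : ∀ {x} n → ¬ x ≈ 0# → ¬ x ^ n ≈ 0#
  x^n≉0 zero    x≉0 = 1≉0
  x^n≉0 (suc n) x≉0 = x*y≉0 x≉0 (x^n≉0 n x≉0)

  x^n≈0⇒x≈0 : ∀ {x} n → x ^ n ≈ 0# → x ≈ 0#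
  x^n≈0⇒x≈0 {x} n xⁿ≈0 with x ≟ 0#
  ... | yes x≈0 = x≈0
  ... | no x≉0  = contradiction xⁿ≈0 (x^n≉0 n x≉0)

  toUnit : Carrier → Carrier
  toUnit x with x ≟ 0#
  ... | yes _ = 1#
  ... | no _  = x

  toUnit-≉0 : ∀ x → ¬ toUnit x ≈ 0#
  toUnit-≉0 x with x ≟ 0#
  ... | yes _   = 1≉0
  ... | no x≉0  = x≉0

  toUnit-0 : ∀ {x} → x ≈ 0# → toUnit x ≈ 1#
  toUnit-0 {x} x≈0 with x ≟ 0#
  ... | yes _   = refl
  ... | no x≉0  = contradiction x≈0 x≉0

  toUnit-≉0-id : ∀ {x} → ¬ x ≈ 0# → toUnit x ≈ x
  toUnit-≉0-id {x} x≉0 with x ≟ 0#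
  ... | yes x≈0 = contradiction x≈0 x≉0
  ... | no _    = refl

  toUnit-cong : ∀ {x y} → x ≈ y → toUnit x ≈ toUnit y
  toUnit-cong {x} {y} x≈y with y ≟ 0#
  ... | yes y≈0 = toUnit-0 (trans x≈y y≈0)
  ... | no y≉0  = trans (toUnit-≉0-id (λ x≈0 → y≉0 (trans (sym x≈y) x≈0))) x≈y

  private
    module Π = CommutativeMonoidSum *-commutativeMonoid
    module Πˣ = CommutativeMonoidSums *-commutativeMonoid

  product-≉0 : ∀ {n} (f : Fin n → Carrier) → (∀ k → ¬ f k ≈ 0#) → ¬ Π.sum f ≈ 0#
  product-≉0 {zero}  f f≉0 = 1≉0
  product-≉0 {suc n} f f≉0 = x*y≉0 (f≉0 zero) (product-≉0 (λ k → f (suc k)) (λ k → f≉0 (suc k)))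

  -- x ↦ a * x permutes F, and a * toUnit x ≈ toUnit (a * x) except at x ≈ 0; compare products over F.
  fermat-≉0 : ∀ {a} → ¬ a ≈ 0# → a ^ (2 ℕ.^ m) ≈ a
  fermat-≉0 {a} a≉0 with inverse a a≉0
  ... | a⁻¹ , aa⁻¹≈1 = *-cancelʳ (product-≉0 units (λ k → toUnit-≉0 (element k))) (begin
    a ^ (2 ℕ.^ m) * Π.sum units                ≈⟨ *-congʳ (Π.sum-replicate n) ⟨
    Π.sum {n} (λ _ → a) * Π.sum units          ≈⟨ Π.∑-distrib-+ (λ _ → a) units ⟨
    Π.sum a*units                              ≈⟨ *-identityˡ _ ⟨
    1# * Π.sum a*units                         ≈⟨ *-congʳ (toUnit-0 (trans (*-congˡ (element-index 0#)) (zeroʳ a))) ⟨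
    units∘a* 0ᵢ * Π.sum a*units                ≈⟨ Πˣ.sum-cross-at a*units units∘a* 0ᵢ agree ⟩
    a*units 0ᵢ * Π.sum units∘a*
      ≈⟨ *-cong (trans (*-congˡ (toUnit-0 (element-index 0#))) (*-identityʳ a)) (sym permuted) ⟩
    a * Π.sum units                            ∎)
    where
    n : ℕ
    n = 2 ℕ.^ m
    units a*units units∘a* : Fin n → Carrier
    units k    = toUnit (element k)
    a*units k  = a * toUnit (element k)
    units∘a* k = toUnit (a * element k)
    0ᵢ : Fin n
    0ᵢ = index 0#
    agree : ∀ k → k ≢ 0ᵢ → a*units k ≈ units∘a* k
    agree k k≢0ᵢ = trans (*-congˡ (toUnit-≉0-id element≉0)) (sym (toUnit-≉0-id (x*y≉0 a≉0 element≉0)))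
      where
      element≉0 : ¬ element k ≈ 0#
      element≉0 e = k≢0ᵢ (≡.trans (≡.sym (index-element k)) (index-cong e))
    cancel : ∀ {b c} → b * c ≈ 1# → ∀ k → index (b * element (index (c * element k))) ≡ k
    cancel {b} {c} bc≈1 k = ≡.trans (index-cong (begin
      b * element (index (c * element k))   ≈⟨ *-congˡ (element-index _) ⟩
      b * (c * element k)                   ≈⟨ *-assoc b c _ ⟨
      (b * c) * element k                   ≈⟨ *-congʳ bc≈1 ⟩
      1# * element k                        ≈⟨ *-identityˡ _ ⟩
      element k                             ∎)) (index-element k)
    π : Permutation n n
    π = mk↔ₛ′ (λ k → index (a * element k)) (λ k → index (a⁻¹ * element k))
              (cancel aa⁻¹≈1) (cancel (trans (*-comm a⁻¹ a) aa⁻¹≈1))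
    permuted : Π.sum units ≈ Π.sum units∘a*
    permuted = trans (Π.sum-permute units π) (Π.sum-cong-≋ {n} λ k → toUnit-cong (element-index _))

  fermat : ∀ x → x ^ (2 ℕ.^ m) ≈ x
  fermat x with x ≟ 0#
  ... | no x≉0  = fermat-≉0 x≉0
  ... | yes x≈0 = trans (^-congˡ (2 ℕ.^ m) x≈0) (trans (0^n≈0 (2 ℕ.^ m) {{ℕ.m^n≢0 2 m}}) (sym x≈0))

  characteristic2 : ∀ {k} → m ≡ suc k → HasCharacteristic2 commRing
  characteristic2 {k} ≡.refl = trans (+-congˡ (sym -1≈1)) (-‿inverseʳ 1#)
    where
    [-1]^2≈1 : (- 1#) ^ 2 ≈ 1#
    [-1]^2≈1 = trans (*-congˡ (*-identityʳ (- 1#))) (trans (-1*x≈-x (- 1#)) (-‿involutive 1#))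
    -1≈1 : - 1# ≈ 1#
    -1≈1 = begin
      - 1#                             ≈⟨ fermat (- 1#) ⟨
      (- 1#) ^ (2 ℕ.* 2 ℕ.^ k)         ≈⟨ ^-assocʳ (- 1#) 2 (2 ℕ.^ k) ⟨
      ((- 1#) ^ 2) ^ (2 ℕ.^ k)         ≈⟨ ^-congˡ (2 ℕ.^ k) [-1]^2≈1 ⟩
      1# ^ (2 ℕ.^ k)                   ≈⟨ 1^n≈1 (2 ℕ.^ k) ⟩
      1#                               ∎

module TraceForm {m c ℓ} (F : FiniteField2^ m c ℓ) (m-odd : m % 2 ≡ 1) where
  open FiniteField2^ F hiding (zero)
  open FiniteFieldProperties F
  open SemiringExp semiring hiding (_^_)
  open GroupProperties +-group using () renaming (∙-cancelʳ to +-cancelʳ)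
  open SetoidReasoning setoid

  m≡1+[m/2]*2 : m ≡ suc (m ℕ./ 2 ℕ.* 2)
  m≡1+[m/2]*2 = ≡.trans (DivMod.m≡m%n+[m/n]*n m 2) (≡.cong (ℕ._+ m ℕ./ 2 ℕ.* 2) m-odd)

  open Characteristic2 commRing (characteristic2 m≡1+[m/2]*2) public

  Tr : Carrier → Carrier
  Tr = tr m

  Tr-cong : ∀ {x y} → x ≈ y → Tr x ≈ Tr y
  Tr-cong = tr-cong m

  Tr-homo-+ : ∀ x y → Tr (x + y) ≈ Tr x + Tr y
  Tr-homo-+ = tr-homo-+ m

  Tr-homo-+³ : ∀ x y z → Tr (x + y + z) ≈ Tr x + Tr y + Tr z
  Tr-homo-+³ x y z = trans (Tr-homo-+ (x + y) z) (+-congʳ (Tr-homo-+ x y))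

  Tr-^2 : ∀ x → Tr (x ^ 2) ≈ Tr x
  Tr-^2 x = +-cancelʳ x (Tr (x ^ 2)) (Tr x) (trans (tr-^2 m x) (+-congˡ (fermat x)))

  Tr-^2^k : ∀ k x → Tr (x ^ (2 ℕ.^ k)) ≈ Tr x
  Tr-^2^k zero    x = Tr-cong (*-identityʳ x)
  Tr-^2^k (suc k) x = begin
    Tr (x ^ (2 ℕ.* 2 ℕ.^ k))     ≈⟨ Tr-cong (^-congʳ x (ℕ.*-comm 2 (2 ℕ.^ k))) ⟩
    Tr (x ^ (2 ℕ.^ k ℕ.* 2))     ≈⟨ Tr-cong (^-assocʳ x (2 ℕ.^ k) 2) ⟨
    Tr ((x ^ (2 ℕ.^ k)) ^ 2)     ≈⟨ Tr-^2 (x ^ (2 ℕ.^ k)) ⟩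
    Tr (x ^ (2 ℕ.^ k))           ≈⟨ Tr-^2^k k x ⟩
    Tr x                         ∎

  Tr-1 : Tr 1# ≈ 1#
  Tr-1 = ≡.subst (λ n → tr n 1# ≈ 1#) (≡.sym m≡1+[m/2]*2) (tr-1-odd (m ℕ./ 2))

  Tr-0 : Tr 0# ≈ 0#
  Tr-0 = trans (Tr-cong (sym (+-identityʳ 0#))) (trans (Tr-homo-+ 0# 0#) (x+x≈0 (Tr 0#)))

  -- If V had no nonzero root it would be injective, hence onto, and V y ≈ u⁻¹ would give Tr 1 ≈ 0.
  trace-orthogonal⇒HasRootInF* : (V : Carrier → Carrier) → (∀ {x y} → x ≈ y → V x ≈ V y) →
                                 (∀ x y → V (x + y) ≈ V x + V y) →
                                 ∀ {u} → ¬ u ≈ 0# → (∀ y → Tr (u * V y) ≈ 0#) → HasRootInF* V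
  trace-orthogonal⇒HasRootInF* V V-cong V-homo-+ {u} u≉0 orthogonal with HasRootInF*? V V-cong
  ... | yes root = root
  ... | no noRoot with inverse u u≉0
  ...   | u⁻¹ , uu⁻¹≈1 = contradiction (begin
      1#                  ≈⟨ Tr-1 ⟨
      Tr 1#               ≈⟨ Tr-cong (trans (*-congˡ (proj₂ onto)) uu⁻¹≈1) ⟨
      Tr (u * V y)        ≈⟨ orthogonal y ⟩
      0#                  ∎) 1≉0
    where
    V-injective : ∀ {x y} → V x ≈ V y → x ≈ y
    V-injective {x} {y} Vx≈Vy with (x + y) ≟ 0#
    ... | yes x+y≈0  = x+y≈0⇒x≈y x+y≈0
    ... | no x+y≉0   = contradiction (x + y , x+y≉0 , trans (V-homo-+ x y) (x≈y⇒x+y≈0 Vx≈Vy)) noRoot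
    onto : ∃ λ y → V y ≈ u⁻¹
    onto = injective⇒surjective V V-cong V-injective u⁻¹
    y : Carrier
    y = proj₁ onto

module Frobenius {m c ℓ} (F : FiniteField2^ m c ℓ) (m-odd : m % 2 ≡ 1)
                 {i} (1≤i : 1 ≤ i) (gcd[i,m]≡1 : gcd i m ≡ 1) where
  open FiniteField2^ F hiding (zero)
  open FiniteFieldProperties F
  open TraceForm F m-odd public
  open SemiringExp semiring hiding (_^_)
  open CommutativeSemiringExp commutativeSemiring using (^-distrib-*)
  open SemiringPowers semiring using (1^n≈1; 0^n≈0; ^n-fixed-of-coprime)
  open Polys F i using (q)
  open SetoidReasoning setoid

  σ : Carrier → Carrier
  σ x = x ^ q

  σ-cong : ∀ {x y} → x ≈ y → σ x ≈ σ y
  σ-cong = ^-congˡ q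

  σ-homo-+ : ∀ x y → σ (x + y) ≈ σ x + σ y
  σ-homo-+ = ^2^k-homo-+ i

  σ-homo-* : ∀ x y → σ (x * y) ≈ σ x * σ y
  σ-homo-* x y = ^-distrib-* x y q

  σ-homo-1 : σ 1# ≈ 1#
  σ-homo-1 = 1^n≈1 q

  σ-homo-0 : σ 0# ≈ 0#
  σ-homo-0 = 0^n≈0 q {{ℕ.m^n≢0 2 i}}

  σ-^ : ∀ x k → σ (x ^ k) ≈ σ x ^ k
  σ-^ x k = trans (^-assocʳ x k q) (trans (^-congʳ x (ℕ.*-comm k q)) (sym (^-assocʳ x q k)))

  σ≈0⇒≈0 : ∀ {x} → σ x ≈ 0# → x ≈ 0#
  σ≈0⇒≈0 = x^n≈0⇒x≈0 q

  σ-≉0 : ∀ {x} → ¬ x ≈ 0# → ¬ σ x ≈ 0#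
  σ-≉0 = x^n≉0 q

  σ-injective : ∀ {x y} → σ x ≈ σ y → x ≈ y
  σ-injective {x} {y} σx≈σy = x+y≈0⇒x≈y (σ≈0⇒≈0 (trans (σ-homo-+ x y) (x≈y⇒x+y≈0 σx≈σy)))

  σ-surjective : ∀ y → ∃ λ x → σ x ≈ y
  σ-surjective = injective⇒surjective σ σ-cong σ-injective

  Tr-σ : ∀ x → Tr (σ x) ≈ Tr x
  Tr-σ = Tr-^2^k i

  σ² σ³ : Carrier → Carrier
  σ² x = σ (σ x)
  σ³ x = σ (σ² x)

  σ²≈^q² : ∀ x → σ² x ≈ x ^ (q ℕ.* q)
  σ²≈^q² x = ^-assocʳ x q q

  σ³≈^q³ : ∀ x → σ³ x ≈ x ^ (q ℕ.* q ℕ.* q)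
  σ³≈^q³ x = trans (σ-cong (σ²≈^q² x)) (^-assocʳ x (q ℕ.* q) q)

  σ²-homo-* : ∀ x y → σ² (x * y) ≈ σ² x * σ² y
  σ²-homo-* x y = trans (σ-cong (σ-homo-* x y)) (σ-homo-* (σ x) (σ y))

  σ³-homo-* : ∀ x y → σ³ (x * y) ≈ σ³ x * σ³ y
  σ³-homo-* x y = trans (σ-cong (σ²-homo-* x y)) (σ-homo-* (σ² x) (σ² y))

  σ²-homo-+ : ∀ x y → σ² (x + y) ≈ σ² x + σ² y
  σ²-homo-+ x y = trans (σ-cong (σ-homo-+ x y)) (σ-homo-+ (σ x) (σ y))

  σ³-homo-+ : ∀ x y → σ³ (x + y) ≈ σ³ x + σ³ y
  σ³-homo-+ x y = trans (σ-cong (σ²-homo-+ x y)) (σ-homo-+ (σ² x) (σ² y))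

  Tr-σ² : ∀ x → Tr (σ² x) ≈ Tr x
  Tr-σ² x = trans (Tr-σ (σ x)) (Tr-σ x)

  Tr-σ³ : ∀ x → Tr (σ³ x) ≈ Tr x
  Tr-σ³ x = trans (Tr-σ (σ² x)) (Tr-σ² x)

  σ-fixed⇒≈1 : ∀ {w} → ¬ w ≈ 0# → σ w ≈ w → w ≈ 1#
  σ-fixed⇒≈1 {w} w≉0 σw≈w = *-cancelʳ w≉0 (begin
    w * w      ≈⟨ *-congˡ (*-identityʳ w) ⟨
    w ^ 2      ≈⟨ ^n-fixed-of-coprime 2 i m gcd[i,m]≡1 σw≈w (fermat w) ⟩
    w          ≈⟨ *-identityˡ w ⟨
    1# * w     ∎)

  r : ℕ
  r = q ℕ.∸ 2

  q≡2+r : q ≡ 2 ℕ.+ r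
  q≡2+r = ≡.sym (ℕ.m+[n∸m]≡n (ℕ.^-monoʳ-≤ 2 1≤i))

  ρ : Carrier → Carrier
  ρ x = x ^ suc r

  ρ-cong : ∀ {x y} → x ≈ y → ρ x ≈ ρ y
  ρ-cong = ^-congˡ (suc r)

  σ≈*ρ : ∀ x → σ x ≈ x * ρ x
  σ≈*ρ x = ^-congʳ x q≡2+r

  ρ-homo-0 : ρ 0# ≈ 0#
  ρ-homo-0 = zeroˡ (0# ^ r)

  ρ≈0⇒≈0 : ∀ {x} → ρ x ≈ 0# → x ≈ 0#
  ρ≈0⇒≈0 = x^n≈0⇒x≈0 (suc r)

  ρ-injective : ∀ {x y} → ρ x ≈ ρ y → x ≈ y
  ρ-injective {x} {y} ρx≈ρy with x ≟ 0# | y ≟ 0#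
  ... | yes x≈0 | yes y≈0 = trans x≈0 (sym y≈0)
  ... | yes x≈0 | no y≉0  = contradiction (ρ≈0⇒≈0 (trans (sym ρx≈ρy) (trans (ρ-cong x≈0) ρ-homo-0))) y≉0
  ... | no x≉0  | yes y≈0 = contradiction (ρ≈0⇒≈0 (trans ρx≈ρy (trans (ρ-cong y≈0) ρ-homo-0))) x≉0
  ... | no x≉0  | no y≉0 with inverse y y≉0
  ...   | y⁻¹ , yy⁻¹≈1 =
    *-cancelʳ y⁻¹≉0 (trans (σ-fixed⇒≈1 (x*y≉0 x≉0 y⁻¹≉0) σ-fixed) (sym yy⁻¹≈1))
    where
    y⁻¹≉0 : ¬ y⁻¹ ≈ 0#
    y⁻¹≉0 = x*y≈1⇒y≉0 yy⁻¹≈1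
    ρ[xy⁻¹]≈1 : ρ (x * y⁻¹) ≈ 1#
    ρ[xy⁻¹]≈1 = begin
      ρ (x * y⁻¹)      ≈⟨ ^-distrib-* x y⁻¹ (suc r) ⟩
      ρ x * ρ y⁻¹      ≈⟨ *-congʳ ρx≈ρy ⟩
      ρ y * ρ y⁻¹      ≈⟨ ^-distrib-* y y⁻¹ (suc r) ⟨
      ρ (y * y⁻¹)      ≈⟨ ρ-cong yy⁻¹≈1 ⟩
      ρ 1#             ≈⟨ 1^n≈1 (suc r) ⟩
      1#               ∎
    σ-fixed : σ (x * y⁻¹) ≈ x * y⁻¹
    σ-fixed = trans (σ≈*ρ (x * y⁻¹)) (trans (*-congˡ ρ[xy⁻¹]≈1) (*-identityʳ (x * y⁻¹)))

  ρ-surjective : ∀ y → ∃ λ x → ρ x ≈ y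
  ρ-surjective = injective⇒surjective ρ ρ-cong ρ-injective

  HasRootInF*-ρ : (f g : Carrier → Carrier) → (∀ {x y} → x ≈ y → f x ≈ f y) →
                  (∀ u → u * f (ρ u) ≈ g u) → HasRootInF* f ⇔ HasRootInF* g
  HasRootInF*-ρ f g f-cong u*f[ρu]≈gu = mk⇔
    (λ (x , x≉0 , fx≈0) → let (u , ρu≈x) = ρ-surjective x in
      u , (λ u≈0 → x≉0 (trans (sym ρu≈x) (trans (ρ-cong u≈0) ρ-homo-0))) ,
      trans (sym (u*f[ρu]≈gu u)) (trans (*-congˡ (trans (f-cong ρu≈x) fx≈0)) (zeroʳ u)))
    (λ (u , u≉0 , gu≈0) → ρ u , x^n≉0 (suc r) u≉0 , x*y≈0⇒y≈0 u≉0 (trans (u*f[ρu]≈gu u) gu≈0))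

  HasRootInF*-σ : (f : Carrier → Carrier → Carrier) → (∀ a {x y} → x ≈ y → f a x ≈ f a y) →
                  (∀ a x → σ (f a x) ≈ f (σ a) (σ x)) → ∀ a → HasRootInF* (f a) ⇔ HasRootInF* (f (σ a))
  HasRootInF*-σ f f-cong f-σ a = mk⇔
    (λ (x , x≉0 , fx≈0) → σ x , σ-≉0 x≉0 , trans (sym (f-σ a x)) (trans (σ-cong fx≈0) σ-homo-0))
    (λ (y , y≉0 , fy≈0) → let (x , σx≈y) = σ-surjective y in
      x , (λ x≈0 → y≉0 (trans (sym σx≈y) (trans (σ-cong x≈0) σ-homo-0))) ,
      σ≈0⇒≈0 (trans (f-σ a x) (trans (f-cong (σ a) σx≈y) fy≈0)))

1+p[q²+q+1]≡q³ : ∀ p → suc (p ℕ.* (suc p ℕ.* suc p ℕ.+ suc p ℕ.+ 1)) ≡ suc p ℕ.* suc p ℕ.* suc p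
1+p[q²+q+1]≡q³ = solve-∀

1+p[q+1]≡q² : ∀ p → suc (p ℕ.* (suc p ℕ.+ 1)) ≡ suc p ℕ.* suc p
1+p[q+1]≡q² = solve-∀

q²+q+1≡1+[q+1]q : ∀ q → q ℕ.* q ℕ.+ q ℕ.+ 1 ≡ suc ((q ℕ.+ 1) ℕ.* q)
q²+q+1≡1+[q+1]q = solve-∀

q²+q+1≡q[q+1]+1 : ∀ q → q ℕ.* q ℕ.+ q ℕ.+ 1 ≡ q ℕ.* (q ℕ.+ 1) ℕ.+ 1
q²+q+1≡q[q+1]+1 = solve-∀

[q+1]q≡q²+q : ∀ q → (q ℕ.+ 1) ℕ.* q ≡ q ℕ.* q ℕ.+ q
[q+1]q≡q²+q = solve-∀

module LinearizedPolynomials {m c ℓ} (F : FiniteField2^ m c ℓ) (m-odd : m % 2 ≡ 1)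
                             {i} (1≤i : 1 ≤ i) (gcd[i,m]≡1 : gcd i m ≡ 1) where
  open FiniteField2^ F hiding (zero)
  open Frobenius F m-odd 1≤i gcd[i,m]≡1
  open SemiringExp semiring hiding (_^_)
  open ThreeTermSums semiring
  open Polys F i using (q; N)
  open CommutativeSemigroupProperties *-commutativeSemigroup using (x∙yz≈y∙xz)
  open CommutativeSemigroupProperties +-commutativeSemigroup using () renaming (xy∙z≈zy∙x to x+y+z≈z+y+x)
  open SetoidReasoning setoid

  Q S : Carrier → Carrier → Carrier
  Q a T = T ^ N + a * T + 1#
  S a T = T ^ N + a * T ^ (q ℕ.+ 1) + 1#

  Q-cong : ∀ a {x y} → x ≈ y → Q a x ≈ Q a y
  Q-cong a x≈y = +-congʳ (+-cong (^-congˡ N x≈y) (*-congˡ x≈y))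

  S-cong : ∀ a {x y} → x ≈ y → S a x ≈ S a y
  S-cong a x≈y = +-congʳ (+-cong (^-congˡ N x≈y) (*-congˡ (^-congˡ (q ℕ.+ 1) x≈y)))

  u*ρu^N≈σ³u : ∀ u → u * ρ u ^ N ≈ σ³ u
  u*ρu^N≈σ³u u = begin
    u * ρ u ^ N                ≈⟨ *-congˡ (^-assocʳ u (suc r) N) ⟩
    u ^ suc (suc r ℕ.* N)      ≈⟨ ^-congʳ u exponent ⟩
    u ^ (q ℕ.* q ℕ.* q)        ≈⟨ σ³≈^q³ u ⟨
    σ³ u                       ∎
    where
    exponent : suc (suc r ℕ.* N) ≡ q ℕ.* q ℕ.* q
    exponent = ≡.subst (λ q → suc (suc r ℕ.* (q ℕ.* q ℕ.+ q ℕ.+ 1)) ≡ q ℕ.* q ℕ.* q)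
                       (≡.sym q≡2+r) (1+p[q²+q+1]≡q³ (suc r))

  u*ρu^[q+1]≈σ²u : ∀ u → u * ρ u ^ (q ℕ.+ 1) ≈ σ² u
  u*ρu^[q+1]≈σ²u u = begin
    u * ρ u ^ (q ℕ.+ 1)            ≈⟨ *-congˡ (^-assocʳ u (suc r) (q ℕ.+ 1)) ⟩
    u ^ suc (suc r ℕ.* (q ℕ.+ 1))  ≈⟨ ^-congʳ u exponent ⟩
    u ^ (q ℕ.* q)                  ≈⟨ σ²≈^q² u ⟨
    σ² u                           ∎
    where
    exponent : suc (suc r ℕ.* (q ℕ.+ 1)) ≡ q ℕ.* q
    exponent = ≡.subst (λ q → suc (suc r ℕ.* (q ℕ.+ 1)) ≡ q ℕ.* q) (≡.sym q≡2+r) (1+p[q+1]≡q² (suc r))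

  L M : Carrier → Carrier → Carrier
  L a u = σ³ u + a * σ u + u
  M d v = σ³ v + d * σ² v + v

  u*Q[ρu]≈L : ∀ a u → u * Q a (ρ u) ≈ L a u
  u*Q[ρu]≈L a u = begin
    u * (ρ u ^ N + a * ρ u + 1#)                 ≈⟨ *-distribˡ-+³ u _ _ _ ⟩
    u * ρ u ^ N + u * (a * ρ u) + u * 1#         ≈⟨ +-cong (+-cong (u*ρu^N≈σ³u u) u*[a*ρu]≈a*σu) (*-identityʳ u) ⟩
    σ³ u + a * σ u + u                           ∎
    where
    u*[a*ρu]≈a*σu : u * (a * ρ u) ≈ a * σ u
    u*[a*ρu]≈a*σu = trans (x∙yz≈y∙xz u a (ρ u)) (*-congˡ (sym (σ≈*ρ u)))

  v*S[ρv]≈M : ∀ d v → v * S d (ρ v) ≈ M d v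
  v*S[ρv]≈M d v = begin
    v * (ρ v ^ N + d * ρ v ^ (q ℕ.+ 1) + 1#)             ≈⟨ *-distribˡ-+³ v _ _ _ ⟩
    v * ρ v ^ N + v * (d * ρ v ^ (q ℕ.+ 1)) + v * 1#     ≈⟨ +-cong (+-cong (u*ρu^N≈σ³u v) v*[d*ρv^[q+1]]≈d*σ²v) (*-identityʳ v) ⟩
    σ³ v + d * σ² v + v                                  ∎
    where
    v*[d*ρv^[q+1]]≈d*σ²v : v * (d * ρ v ^ (q ℕ.+ 1)) ≈ d * σ² v
    v*[d*ρv^[q+1]]≈d*σ²v = trans (x∙yz≈y∙xz v d _) (*-congˡ (u*ρu^[q+1]≈σ²u v))

  Tr-adjoint : ∀ a x y → Tr (σ³ x * M (σ² a) y) ≈ Tr (L a x * y)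
  Tr-adjoint a x y = begin
    Tr (σ³ x * (σ³ y + σ² a * σ² y + y))                        ≈⟨ Tr-cong (*-distribˡ-+³ (σ³ x) _ _ _) ⟩
    Tr (σ³ x * σ³ y + σ³ x * (σ² a * σ² y) + σ³ x * y)          ≈⟨ Tr-homo-+³ _ _ _ ⟩
    Tr (σ³ x * σ³ y) + Tr (σ³ x * (σ² a * σ² y)) + Tr (σ³ x * y) ≈⟨ +-congʳ (+-cong Tr[σ³x*σ³y] Tr[σ³x*σ²a*σ²y]) ⟩
    Tr (x * y) + Tr ((a * σ x) * y) + Tr (σ³ x * y)             ≈⟨ x+y+z≈z+y+x _ _ _ ⟩
    Tr (σ³ x * y) + Tr ((a * σ x) * y) + Tr (x * y)             ≈⟨ Tr-homo-+³ _ _ _ ⟨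
    Tr (σ³ x * y + (a * σ x) * y + x * y)                       ≈⟨ Tr-cong (*-distribʳ-+³ y _ _ _) ⟨
    Tr ((σ³ x + a * σ x + x) * y)                               ∎
    where
    Tr[σ³x*σ³y] : Tr (σ³ x * σ³ y) ≈ Tr (x * y)
    Tr[σ³x*σ³y] = trans (Tr-cong (sym (σ³-homo-* x y))) (Tr-σ³ (x * y))
    Tr[σ³x*σ²a*σ²y] : Tr (σ³ x * (σ² a * σ² y)) ≈ Tr ((a * σ x) * y)
    Tr[σ³x*σ²a*σ²y] = begin
      Tr (σ³ x * (σ² a * σ² y))       ≈⟨ Tr-cong (*-congˡ (σ²-homo-* a y)) ⟨
      Tr (σ² (σ x) * σ² (a * y))      ≈⟨ Tr-cong (σ²-homo-* (σ x) (a * y)) ⟨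
      Tr (σ² (σ x * (a * y)))         ≈⟨ Tr-σ² _ ⟩
      Tr (σ x * (a * y))              ≈⟨ Tr-cong (trans (x∙yz≈y∙xz (σ x) a y) (sym (*-assoc a (σ x) y))) ⟩
      Tr ((a * σ x) * y)              ∎

  L-cong : ∀ a {x y} → x ≈ y → L a x ≈ L a y
  L-cong a x≈y = +-cong (+-cong (σ-cong (σ-cong (σ-cong x≈y))) (*-congˡ (σ-cong x≈y))) x≈y

  M-cong : ∀ d {x y} → x ≈ y → M d x ≈ M d y
  M-cong d x≈y = +-cong (+-cong (σ-cong (σ-cong (σ-cong x≈y))) (*-congˡ (σ-cong (σ-cong x≈y)))) x≈y

  L-homo-+ : ∀ a x y → L a (x + y) ≈ L a x + L a y
  L-homo-+ a x y =
    trans (+-congʳ (+-cong (σ³-homo-+ x y) (trans (*-congˡ (σ-homo-+ x y)) (distribˡ a (σ x) (σ y)))))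
          (+-interchange³ _ _ _ _ _ _)

  M-homo-+ : ∀ d x y → M d (x + y) ≈ M d x + M d y
  M-homo-+ d x y =
    trans (+-congʳ (+-cong (σ³-homo-+ x y) (trans (*-congˡ (σ²-homo-+ x y)) (distribˡ d (σ² x) (σ² y)))))
          (+-interchange³ _ _ _ _ _ _)

  L⇔M : ∀ a → HasRootInF* (L a) ⇔ HasRootInF* (M (σ² a))
  L⇔M a = mk⇔
    (λ (u , u≉0 , Lu≈0) → trace-orthogonal⇒HasRootInF* (M (σ² a)) (M-cong (σ² a)) (M-homo-+ (σ² a))
      (σ-≉0 (σ-≉0 (σ-≉0 u≉0)))
      (λ y → trans (Tr-adjoint a u y) (trans (Tr-cong (trans (*-congʳ Lu≈0) (zeroˡ y))) Tr-0)))
    (λ (v , v≉0 , Mv≈0) → trace-orthogonal⇒HasRootInF* (L a) (L-cong a) (L-homo-+ a) v≉0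
      (λ x → begin
        Tr (v * L a x)                ≈⟨ Tr-cong (*-comm v (L a x)) ⟩
        Tr (L a x * v)                ≈⟨ Tr-adjoint a x v ⟨
        Tr (σ³ x * M (σ² a) v)        ≈⟨ Tr-cong (trans (*-congˡ Mv≈0) (zeroʳ (σ³ x))) ⟩
        Tr 0#                         ≈⟨ Tr-0 ⟩
        0#                            ∎))

  Q⇔S : ∀ a → HasRootInF* (Q a) ⇔ HasRootInF* (S (σ² a))
  Q⇔S a = ⇔-trans (HasRootInF*-ρ (Q a) (L a) (Q-cong a) (u*Q[ρu]≈L a))
         (⇔-trans (L⇔M a) (⇔-sym (HasRootInF*-ρ (S (σ² a)) (M (σ² a)) (S-cong (σ² a)) (v*S[ρv]≈M (σ² a)))))

module RootEquivalences {m c ℓ} (F : FiniteField2^ m c ℓ) (m-odd : m % 2 ≡ 1)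
                        {i} (1≤i : 1 ≤ i) (gcd[i,m]≡1 : gcd i m ≡ 1) where
  open FiniteField2^ F hiding (zero)
  open FiniteFieldProperties F
  open Frobenius F m-odd 1≤i gcd[i,m]≡1
  open LinearizedPolynomials F m-odd 1≤i gcd[i,m]≡1
  open SemiringExp semiring hiding (_^_)
  open CommutativeSemiringExp commutativeSemiring using (^-distrib-*)
  open SemiringPowers semiring using (1^n≈1; 0^[n+1]≈0)
  open ThreeTermSums semiring
  open Polys F i using (q; N; poly)
  open CommutativeSemigroupProperties *-commutativeSemigroup using (x∙yz≈y∙xz)
  open CommutativeSemigroupProperties +-commutativeSemigroup using () renaming (xy∙z≈zy∙x to x+y+z≈z+y+x)
  open SetoidReasoning setoid

  z^N≈z*σ[z^[q+1]] : ∀ z → z ^ N ≈ z * σ (z ^ (q ℕ.+ 1))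
  z^N≈z*σ[z^[q+1]] z = trans (^-congʳ z (q²+q+1≡1+[q+1]q q)) (*-congˡ (sym (^-assocʳ z (q ℕ.+ 1) q)))

  x^N≈σx^[q+1]*x : ∀ x → x ^ N ≈ σ x ^ (q ℕ.+ 1) * x
  x^N≈σx^[q+1]*x x = begin
    x ^ N                           ≈⟨ ^-congʳ x (q²+q+1≡q[q+1]+1 q) ⟩
    x ^ (q ℕ.* (q ℕ.+ 1) ℕ.+ 1)     ≈⟨ ^-homo-* x (q ℕ.* (q ℕ.+ 1)) 1 ⟩
    x ^ (q ℕ.* (q ℕ.+ 1)) * x ^ 1   ≈⟨ *-cong (^-assocʳ x q (q ℕ.+ 1)) (sym (*-identityʳ x)) ⟨
    σ x ^ (q ℕ.+ 1) * x             ∎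

  -- On roots, x = z ^ (q + 1) and z = (a * E x + 1) / x ^ q are mutually inverse.
  HasRootInF*-[q+1] : ∀ a (E K : Carrier → Carrier) → (∀ {x y} → x ≈ y → E x ≈ E y) →
                      (∀ z → E (z ^ (q ℕ.+ 1)) ≈ K z) →
                      HasRootInF* (λ x → x ^ N + (a * E x + 1#) ^ (q ℕ.+ 1)) ⇔
                      HasRootInF* (λ z → z ^ N + a * K z + 1#)
  HasRootInF*-[q+1] a E K E-cong E[z^[q+1]]≈Kz = mk⇔ to from
    where
    P₁ P₂ : Carrier → Carrier
    P₁ x = x ^ N + (a * E x + 1#) ^ (q ℕ.+ 1)
    P₂ z = z ^ N + a * K z + 1#
    to : HasRootInF* P₁ → HasRootInF* P₂
    to (x , x≉0 , root) with inverse (σ x) (σ-≉0 x≉0)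
    ... | w , σx*w≈1 = z , z≉0 , (begin
      z ^ N + a * K z + 1#
        ≈⟨ +-congʳ (+-cong (z^N≈z*σ[z^[q+1]] z) (*-congˡ (sym (E[z^[q+1]]≈Kz z)))) ⟩
      z * σ (z ^ (q ℕ.+ 1)) + a * E (z ^ (q ℕ.+ 1)) + 1#
        ≈⟨ +-congʳ (+-cong (*-congˡ (σ-cong x≈z^[q+1])) (*-congˡ (E-cong x≈z^[q+1]))) ⟨
      z * σ x + a * E x + 1#                         ≈⟨ +-congʳ (+-congʳ z*σx≈aEx+1) ⟩
      (a * E x + 1#) + a * E x + 1#                  ≈⟨ +-assoc (a * E x + 1#) (a * E x) 1# ⟩
      (a * E x + 1#) + (a * E x + 1#)                ≈⟨ x+x≈0 (a * E x + 1#) ⟩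
      0#                                             ∎)
      where
      z : Carrier
      z = (a * E x + 1#) * w
      z*σx≈aEx+1 : z * σ x ≈ a * E x + 1#
      z*σx≈aEx+1 = trans (*-assoc _ w (σ x)) (trans (*-congˡ (trans (*-comm w (σ x)) σx*w≈1)) (*-identityʳ _))
      x≈z^[q+1] : x ≈ z ^ (q ℕ.+ 1)
      x≈z^[q+1] = *-cancelʳ (x^n≉0 (q ℕ.+ 1) (σ-≉0 x≉0)) (begin
        x * σ x ^ (q ℕ.+ 1)                 ≈⟨ *-comm x _ ⟩
        σ x ^ (q ℕ.+ 1) * x                 ≈⟨ x^N≈σx^[q+1]*x x ⟨
        x ^ N                               ≈⟨ x+y≈0⇒x≈y root ⟩
        (a * E x + 1#) ^ (q ℕ.+ 1)          ≈⟨ ^-congˡ (q ℕ.+ 1) z*σx≈aEx+1 ⟨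
        (z * σ x) ^ (q ℕ.+ 1)               ≈⟨ ^-distrib-* z (σ x) (q ℕ.+ 1) ⟩
        z ^ (q ℕ.+ 1) * σ x ^ (q ℕ.+ 1)     ∎)
      z≉0 : ¬ z ≈ 0#
      z≉0 z≈0 = x≉0 (trans x≈z^[q+1] (trans (^-congˡ (q ℕ.+ 1) z≈0) (0^[n+1]≈0 q)))
    from : HasRootInF* P₂ → HasRootInF* P₁
    from (z , z≉0 , root) = x , x≉0 , x≈y⇒x+y≈0 (begin
      x ^ N                           ≈⟨ x^N≈σx^[q+1]*x x ⟩
      σ x ^ (q ℕ.+ 1) * x             ≈⟨ *-comm _ x ⟩
      z ^ (q ℕ.+ 1) * σ x ^ (q ℕ.+ 1) ≈⟨ ^-distrib-* z (σ x) (q ℕ.+ 1) ⟨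
      (z * σ x) ^ (q ℕ.+ 1)           ≈⟨ ^-congˡ (q ℕ.+ 1) z*σx≈aEx+1 ⟩
      (a * E x + 1#) ^ (q ℕ.+ 1)      ∎)
      where
      x : Carrier
      x = z ^ (q ℕ.+ 1)
      x≉0 : ¬ x ≈ 0#
      x≉0 = x^n≉0 (q ℕ.+ 1) z≉0
      z*σx≈aEx+1 : z * σ x ≈ a * E x + 1#
      z*σx≈aEx+1 = begin
        z * σ x              ≈⟨ z^N≈z*σ[z^[q+1]] z ⟨
        z ^ N                ≈⟨ x+y+z≈0⇒x≈y+z root ⟩
        a * K z + 1#         ≈⟨ +-congʳ (*-congˡ (E[z^[q+1]]≈Kz z)) ⟨
        a * E x + 1#         ∎

  P′ : Carrier → Carrier → Carrier
  P′ a T = T ^ N + a * T ^ (q ℕ.* q ℕ.+ q) + 1#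

  σ[z^[q+1]]≈z^[q²+q] : ∀ z → σ (z ^ (q ℕ.+ 1)) ≈ z ^ (q ℕ.* q ℕ.+ q)
  σ[z^[q+1]]≈z^[q²+q] z = trans (^-assocʳ z (q ℕ.+ 1) q) (^-congʳ z ([q+1]q≡q²+q q))

  P⇔P′ : ∀ a → HasRootInF* (poly 0F a) ⇔ HasRootInF* (P′ a)
  P⇔P′ a = HasRootInF*-[q+1] a σ (_^ (q ℕ.* q ℕ.+ q)) σ-cong σ[z^[q+1]]≈z^[q²+q]

  R⇔S : ∀ a → HasRootInF* (poly 4F a) ⇔ HasRootInF* (S a)
  R⇔S a = HasRootInF*-[q+1] a (λ x → x) (_^ (q ℕ.+ 1)) (λ x≈y → x≈y) (λ _ → refl)

  z^N*Q[x]≈P′[z] : ∀ a {x z} → x * z ≈ 1# → z ^ N * Q a x ≈ P′ a z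
  z^N*Q[x]≈P′[z] a {x} {z} xz≈1 = begin
    z ^ N * (x ^ N + a * x + 1#)                          ≈⟨ *-distribˡ-+³ (z ^ N) _ _ _ ⟩
    z ^ N * x ^ N + z ^ N * (a * x) + z ^ N * 1#          ≈⟨ +-cong (+-cong [zx]^N≈1 z^N*ax≈a*z^[q²+q]) (*-identityʳ (z ^ N)) ⟩
    1# + a * z ^ (q ℕ.* q ℕ.+ q) + z ^ N                  ≈⟨ x+y+z≈z+y+x 1# _ (z ^ N) ⟩
    z ^ N + a * z ^ (q ℕ.* q ℕ.+ q) + 1#                  ∎
    where
    zx≈1 : z * x ≈ 1#
    zx≈1 = trans (*-comm z x) xz≈1
    [zx]^N≈1 : z ^ N * x ^ N ≈ 1#
    [zx]^N≈1 = trans (sym (^-distrib-* z x N)) (trans (^-congˡ N zx≈1) (1^n≈1 N))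
    z^N*ax≈a*z^[q²+q] : z ^ N * (a * x) ≈ a * z ^ (q ℕ.* q ℕ.+ q)
    z^N*ax≈a*z^[q²+q] = begin
      z ^ N * (a * x)                          ≈⟨ x∙yz≈y∙xz (z ^ N) a x ⟩
      a * (z ^ N * x)                          ≈⟨ *-congˡ (*-congʳ (^-homo-* z (q ℕ.* q ℕ.+ q) 1)) ⟩
      a * ((z ^ (q ℕ.* q ℕ.+ q) * z ^ 1) * x)  ≈⟨ *-congˡ (*-assoc _ (z ^ 1) x) ⟩
      a * (z ^ (q ℕ.* q ℕ.+ q) * (z ^ 1 * x))  ≈⟨ *-congˡ (*-congˡ (trans (*-congʳ (*-identityʳ z)) zx≈1)) ⟩
      a * (z ^ (q ℕ.* q ℕ.+ q) * 1#)           ≈⟨ *-congˡ (*-identityʳ _) ⟩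
      a * z ^ (q ℕ.* q ℕ.+ q)                  ∎

  Q⇔P′ : ∀ a → HasRootInF* (Q a) ⇔ HasRootInF* (P′ a)
  Q⇔P′ a = mk⇔
    (λ (x , x≉0 , Qx≈0) → let (z , xz≈1) = inverse x x≉0 in
      z , x*y≈1⇒y≉0 xz≈1 , trans (sym (z^N*Q[x]≈P′[z] a xz≈1)) (trans (*-congˡ Qx≈0) (zeroʳ (z ^ N))))
    (λ (z , z≉0 , P′z≈0) → let (x , zx≈1) = inverse z z≉0 in
      x , x*y≈1⇒y≉0 zx≈1 ,
      x*y≈0⇒y≈0 (x^n≉0 N z≉0) (trans (z^N*Q[x]≈P′[z] a (trans (*-comm x z) zx≈1)) P′z≈0))

  σ[x+y+1]≈σx+σy+1 : ∀ x y → σ (x + y + 1#) ≈ σ x + σ y + 1#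
  σ[x+y+1]≈σx+σy+1 x y = trans (σ-homo-+ (x + y) 1#) (+-cong (σ-homo-+ x y) σ-homo-1)

  Q-σ : ∀ a x → σ (Q a x) ≈ Q (σ a) (σ x)
  Q-σ a x = trans (σ[x+y+1]≈σx+σy+1 _ _) (+-congʳ (+-cong (σ-^ x N) (σ-homo-* a x)))

  S-σ : ∀ a x → σ (S a x) ≈ S (σ a) (σ x)
  S-σ a x = trans (σ[x+y+1]≈σx+σy+1 _ _)
                  (+-congʳ (+-cong (σ-^ x N) (trans (σ-homo-* a _) (*-congˡ (σ-^ x (q ℕ.+ 1))))))

  poly⇔Q : ∀ a k → HasRootInF* (poly k a) ⇔ HasRootInF* (Q a)
  poly⇔Q a 0F = ⇔-trans (P⇔P′ a) (⇔-sym (Q⇔P′ a))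
  poly⇔Q a 1F = ⇔-sym (Q⇔P′ a)
  poly⇔Q a 2F = ⇔-refl
  poly⇔Q a 3F = ⇔-sym (HasRootInF*-σ Q Q-cong Q-σ a)
  poly⇔Q a 4F = ⇔-trans (R⇔S a) (⇔-trans (HasRootInF*-σ S S-cong S-σ a) (poly⇔Q a 5F))
  poly⇔Q a 5F = ⇔-trans (HasRootInF*-σ S S-cong S-σ (σ a)) (⇔-sym (Q⇔S a))

  0+0+1≈1 : ∀ {x y} → x ≈ 0# → y ≈ 0# → x + y + 1# ≈ 1#
  0+0+1≈1 x≈0 y≈0 = trans (+-congʳ (trans (+-cong x≈0 y≈0) (+-identityʳ 0#))) (+-identityˡ 1#)

  0+1≈1 : ∀ {x y} → x ≈ 0# → y ≈ 1# → x + y ≈ 1#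
  0+1≈1 x≈0 y≈1 = trans (+-cong x≈0 y≈1) (+-identityˡ 1#)

  b*0≈0 : ∀ b {x} → x ≈ 0# → b * x ≈ 0#
  b*0≈0 b x≈0 = trans (*-congˡ x≈0) (zeroʳ b)

  [b*0+1]^[q+1]≈1 : ∀ b {x} → x ≈ 0# → (b * x + 1#) ^ (q ℕ.+ 1) ≈ 1#
  [b*0+1]^[q+1]≈1 b x≈0 = trans (^-congˡ (q ℕ.+ 1) (0+1≈1 (b*0≈0 b x≈0) refl)) (1^n≈1 (q ℕ.+ 1))

  0^N≈0 : 0# ^ N ≈ 0#
  0^N≈0 = 0^[n+1]≈0 (q ℕ.* q ℕ.+ q)

  0^[q²+q]≈0 : 0# ^ (q ℕ.* q ℕ.+ q) ≈ 0#
  0^[q²+q]≈0 = trans (^-homo-* 0# (q ℕ.* q) q) (b*0≈0 _ σ-homo-0)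

  poly-at-0 : ∀ a k → poly k a 0# ≈ 1#
  poly-at-0 a 0F = 0+1≈1 0^N≈0 ([b*0+1]^[q+1]≈1 a σ-homo-0)
  poly-at-0 a 1F = 0+0+1≈1 0^N≈0 (b*0≈0 a 0^[q²+q]≈0)
  poly-at-0 a 2F = 0+0+1≈1 0^N≈0 (zeroʳ a)
  poly-at-0 a 3F = 0+0+1≈1 0^N≈0 (zeroʳ (σ a))
  poly-at-0 a 4F = 0+1≈1 0^N≈0 ([b*0+1]^[q+1]≈1 a refl)
  poly-at-0 a 5F = 0+0+1≈1 0^N≈0 (b*0≈0 (σ a) (0^[n+1]≈0 q))

proposition2p2 : {c ℓ : Level} (m : ℕ) → 3 ≤ m → m % 2 ≡ 1 →
                 (F : FiniteField2^ m c ℓ) → (i : ℕ) → 1 ≤ i → gcd i m ≡ 1 →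
                 (a : FiniteField2^.Carrier F) → ¬ (FiniteField2^._≈_ F a (FiniteField2^.0# F)) →
                 ((k : Fin 6) → FiniteField2^._≈_ F (Polys.poly F i k a (FiniteField2^.0# F)) (FiniteField2^.1# F))
                 × ((j k : Fin 6) → FiniteField2^.HasRootInF* F (Polys.poly F i j a) → FiniteField2^.HasRootInF* F (Polys.poly F i k a))
proposition2p2 m _ m-odd F i 1≤i gcd[i,m]≡1 a _ =
  poly-at-0 a , λ j k root → Equivalence.from (poly⇔Q a k) (Equivalence.to (poly⇔Q a j) root)
  where open RootEquivalences F m-odd 1≤i gcd[i,m]≡1
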